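{- Let $n$ be a positive integer and $t$ an integer with $1\leq t\leq n$. Then \[ \binom{n}{t}=\sum_{m=0}^{\lfloor (n-1)/2\rfloor}\sum_{j=0}^{n-1-2m}(-1)^{m}2^{n-1-2m-j}\binom{n-1-m}{m}\binom{n-1-2m}{j}\binom{m}{t-j-1}. \]
   Context: Binomial coefficients $\binom{a}{b}$ with $a\ge 0$ an integer are $0$ when $b<0$ or $b>a$. -}

module Defs where

open import Data.Nat using (ℕ; zero; suc; _∸_; _/_)
open import Data.Nat.Combinatorics using (_C_)
open import Data.Integer using (ℤ; +_; -[1+_]; _+_; _*_; _-_; -_)
open import Data.Integer.Base using (_^_)

-- Binomial coefficient with natural upper index a and integer lower index b:
-- zero when b < 0; for b ≥ 0 it is the stdlib a C b (which is 0 when b > a).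
binom : ℕ → ℤ → ℤ
binom a (+ b)      = + (a C b)
binom a -[1+ _ ]   = + 0

sumTo : ℕ → (ℕ → ℤ) → ℤ
sumTo zero    f = f 0
sumTo (suc k) f = sumTo k f + f (suc k)

rhs : ℕ → ℕ → ℤ
rhs n t =
  sumTo ((n ∸ 1) / 2) λ m →
    sumTo (n ∸ 1 ∸ 2 Data.Nat.* m) λ j →
      ((- (+ 1)) ^ m) * ((+ 2) ^ (n ∸ 1 ∸ 2 Data.Nat.* m ∸ j))
        * + ((n ∸ 1 ∸ m) C m) * + ((n ∸ 1 ∸ 2 Data.Nat.* m) C j)
        * binom m (+ t - + j - + 1)

-- Write N = n - 1, s = t - 1, and read a ℤ-indexed integer
-- sequence as the coefficient sequence of a (Laurent) polynomial in x.  The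
-- inner sum over j is the coefficient of x^s in (2+x)^(N-2m) (1+x)^m, so the
-- theorem is the coefficient form of the Chebyshev-type identity
--     Σ_m (-1)^m C(N-m, m) (2+x)^(N-2m) (1+x)^m  =  ((1+x)^(N+1) - 1) / x,
-- in which 1+x and 1 are the roots of z² - (2+x) z + (1+x).  Both sides
-- satisfy  F(N+2) = (2+x) F(N+1) - (1+x) F(N)  and agree for N = 0, 1.
--
-- The theorem then follows by truncating the left-hand sum at
-- N/2 (the later terms vanish) and expanding the inner sum.
module Submission where

open import Defs
open import Data.Nat using (ℕ; _≤_)
open import Data.Nat.Combinatorics using (_C_)
open import Data.Integer using (+_)
open import Relation.Binary.PropositionalEquality using (_≡_)

open import Data.Nat as ℕ using (zero; suc; _∸_; _<_; z≤n; s≤s; _/_; _≤′_; ≤′-refl; ≤′-step)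
import Data.Nat.Properties as ℕP
import Data.Nat.DivMod as ℕD
open import Data.Nat.Combinatorics using (k>n⇒nCk≡0; nCk+nC[k+1]≡[n+1]C[k+1])
open import Data.Integer using (ℤ; -[1+_]; _+_; _*_; _-_; -_)
open import Data.Integer.Base using (_^_)
import Data.Integer.Properties as ℤP
open import Data.Integer.Tactic.RingSolver using (solve-∀)
open import Relation.Binary.PropositionalEquality
  using (refl; sym; trans; cong; cong₂; subst; _≗_; module ≡-Reasoning)
open import Relation.Nullary using (yes; no)
open import Data.Empty using (⊥-elim)

open ≡-Reasoning

sumTo-cong : ∀ k {f g : ℕ → ℤ} → f ≗ g → sumTo k f ≡ sumTo k g
sumTo-cong zero    f≗g = f≗g 0
sumTo-cong (suc k) f≗g = cong₂ _+_ (sumTo-cong k f≗g) (f≗g (suc k))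

sumTo-+ : ∀ k (f g : ℕ → ℤ) → sumTo k (λ i → f i + g i) ≡ sumTo k f + sumTo k g
sumTo-+ zero    f g = refl
sumTo-+ (suc k) f g =
  trans (cong (_+ (f (suc k) + g (suc k))) (sumTo-+ k f g))
        (interchange (sumTo k f) (sumTo k g) (f (suc k)) (g (suc k)))
  where
  interchange : ∀ a b c d → (a + b) + (c + d) ≡ (a + c) + (b + d)
  interchange = solve-∀

sumTo-difference : ∀ k (f g : ℕ → ℤ) → sumTo k (λ i → f i - g i) ≡ sumTo k f - sumTo k g
sumTo-difference zero    f g = refl
sumTo-difference (suc k) f g =
  trans (cong (_+ (f (suc k) - g (suc k))) (sumTo-difference k f g))
        (interchange (sumTo k f) (sumTo k g) (f (suc k)) (g (suc k)))
  where
  interchange : ∀ a b c d → (a - b) + (c - d) ≡ (a + c) - (b + d)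
  interchange = solve-∀

sumTo-* : ∀ k c (f : ℕ → ℤ) → sumTo k (λ i → c * f i) ≡ c * sumTo k f
sumTo-* zero    c f = refl
sumTo-* (suc k) c f =
  trans (cong (_+ (c * f (suc k))) (sumTo-* k c f))
        (sym (ℤP.*-distribˡ-+ c (sumTo k f) (f (suc k))))

sumTo-shift : ∀ k (f : ℕ → ℤ) → sumTo (suc k) f ≡ f 0 + sumTo k (λ i → f (suc i))
sumTo-shift zero    f = refl
sumTo-shift (suc k) f =
  trans (cong (_+ f (suc (suc k))) (sumTo-shift k f)) (ℤP.+-assoc (f 0) _ _)

sumTo-truncate : ∀ {B K} (f : ℕ → ℤ) → B ≤ K → (∀ i → B < i → f i ≡ + 0) →
                 sumTo K f ≡ sumTo B f
sumTo-truncate {B} f B≤K vanish = cut (ℕP.≤⇒≤′ B≤K)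
  where
  cut : ∀ {K} → B ≤′ K → sumTo K f ≡ sumTo B f
  cut ≤′-refl            = refl
  cut (≤′-step {K} B≤′K) =
    trans (cong₂ _+_ (cut B≤′K) (vanish (suc K) (s≤s (ℕP.≤′⇒≤ B≤′K))))
          (ℤP.+-identityʳ _)

zero-factor : ∀ p x → p * + 0 * x ≡ + 0
zero-factor p x = cong (_* x) (ℤP.*-zeroʳ p)

pascal : ∀ a k → + (suc a C suc k) ≡ + (a C k) + + (a C suc k)
pascal a k = cong +_ (sym (nCk+nC[k+1]≡[n+1]C[k+1] a k))

-- Coefficient sequence of a Laurent polynomial: s ↦ coefficient of x^s.
Seq : Set
Seq = ℤ → ℤ

-- Coefficients of (c + x) · f.
timesXPlus : ℤ → Seq → Seq
timesXPlus c f s = c * f s + f (s - + 1)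

timesXPlus-cong : ∀ c {f g : Seq} → f ≗ g → timesXPlus c f ≗ timesXPlus c g
timesXPlus-cong c f≗g s = cong₂ (λ u v → c * u + v) (f≗g s) (f≗g (s - + 1))

timesXPlus-scale : ∀ c k (f : Seq) → timesXPlus c (λ s → k * f s) ≗ λ s → k * timesXPlus c f s
timesXPlus-scale c k f s = commute c k (f s) (f (s - + 1))
  where
  commute : ∀ c k u v → c * (k * u) + k * v ≡ k * (c * u + v)
  commute = solve-∀

timesXPlus-sum : ∀ c k (g : ℕ → Seq) →
  (λ s → sumTo k (λ m → timesXPlus c (g m) s)) ≗ timesXPlus c (λ s → sumTo k (λ m → g m s))
timesXPlus-sum c k g s =
  trans (sumTo-+ k (λ m → c * g m s) (λ m → g m (s - + 1)))
        (cong (_+ _) (sumTo-* k c (λ m → g m s)))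

binom-pascal : ∀ m → binom (suc m) ≗ timesXPlus (+ 1) (binom m)
binom-pascal m (+ zero)  = refl
binom-pascal m (+ suc k) =
  trans (pascal m k)
        (trans (ℤP.+-comm (+ (m C k)) (+ (m C suc k)))
              (cong (_+ + (m C k)) (sym (ℤP.*-identityˡ (+ (m C suc k))))))
binom-pascal m -[1+ k ]  = refl

-- Coefficients of (c + x)^a · f, expanded by the binomial theorem.
powerTimes : ℤ → ℕ → Seq → Seq
powerTimes c a f s = sumTo a (λ j → c ^ (a ∸ j) * + (a C j) * f (s - + j))

powerTimes-cong : ∀ c a {f g : Seq} → f ≗ g → powerTimes c a f ≗ powerTimes c a g
powerTimes-cong c a f≗g s = sumTo-cong a (λ j → cong (c ^ (a ∸ j) * + (a C j) *_) (f≗g (s - + j)))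

powerTimes-commute : ∀ c a d (f : Seq) → powerTimes c a (timesXPlus d f) ≗ timesXPlus d (powerTimes c a f)
powerTimes-commute c a d f s =
  trans (sumTo-cong a termwise)
        (timesXPlus-sum d a (λ j s′ → c ^ (a ∸ j) * + (a C j) * f (s′ - + j)) s)
  where
  termwise : ∀ j → c ^ (a ∸ j) * + (a C j) * timesXPlus d f (s - + j)
                 ≡ d * (c ^ (a ∸ j) * + (a C j) * f (s - + j)) + c ^ (a ∸ j) * + (a C j) * f (s - + 1 - + j)
  termwise j = trans (cong (λ v → w * (d * f (s - + j) + f v)) (swap s (+ j)))
                     (distrib w d (f (s - + j)) (f (s - + 1 - + j)))
    where
    w : ℤ
    w = c ^ (a ∸ j) * + (a C j)
    swap : ∀ s i → s - i - + 1 ≡ s - + 1 - i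
    swap = solve-∀
    distrib : ∀ w d u v → w * (d * u + v) ≡ d * (w * u) + w * v
    distrib = solve-∀

-- c^(a-j) C(a, j+1) = c · c^(a-j-1) C(a, j+1); if j+1 > a both sides vanish.
pow-binom-absorb : ∀ c a j → c ^ (a ∸ j) * + (a C suc j) ≡ c * (c ^ (a ∸ suc j) * + (a C suc j))
pow-binom-absorb c a j with suc j ℕ.≤? a
... | yes j<a = trans (cong (λ e → c ^ e * + (a C suc j)) (ℕP.+-∸-assoc 1 j<a))
                      (ℤP.*-assoc c _ _)
... | no  j≮a rewrite k>n⇒nCk≡0 (ℕP.≰⇒> j≮a) =
  trans (ℤP.*-zeroʳ (c ^ (a ∸ j)))
        (sym (trans (cong (c *_) (ℤP.*-zeroʳ (c ^ (a ∸ suc j)))) (ℤP.*-zeroʳ c)))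

powerTimes-suc : ∀ c a (f : Seq) → powerTimes c (suc a) f ≗ timesXPlus c (powerTimes c a f)
powerTimes-suc c a f s = begin
  powerTimes c (suc a) f s                              ≡⟨ sumTo-cong (suc a) split ⟩
  sumTo (suc a) (λ j → c * t j + u j)             ≡⟨ sumTo-+ (suc a) (λ j → c * t j) u ⟩
  sumTo (suc a) (λ j → c * t j) + sumTo (suc a) u ≡⟨ cong₂ _+_ scaled shifted ⟩
  c * powerTimes c a f s + powerTimes c a f (s - + 1)         ∎
  where
  t : ℕ → ℤ
  t j = c ^ (a ∸ j) * + (a C j) * f (s - + j)
  u : ℕ → ℤ
  u zero    = + 0
  u (suc j) = c ^ (a ∸ j) * + (a C j) * f (s - + 1 - + j)

  split : ∀ j → c ^ (suc a ∸ j) * + (suc a C j) * f (s - + j) ≡ c * t j + u j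
  split zero    = first c (c ^ a) (f (s - + 0))
    where
    first : ∀ c p x → c * p * + 1 * x ≡ c * (p * + 1 * x) + + 0
    first = solve-∀
  split (suc j) = begin
    p * + (suc a C suc j) * f (s - + suc j)     ≡⟨ cong (λ k → p * k * f (s - + suc j)) (pascal a j) ⟩
    p * (A + B) * f (s - + suc j)               ≡⟨ expand p A B (f (s - + suc j)) ⟩
    p * B * f (s - + suc j) + p * A * f (s - + suc j)
      ≡⟨ cong₂ (λ l r → l * f (s - + suc j) + p * A * f r) (pow-binom-absorb c a j) (shift s (+ j)) ⟩
    c * (c ^ (a ∸ suc j) * B) * f (s - + suc j) + u (suc j)
      ≡⟨ cong (_+ u (suc j)) (ℤP.*-assoc c _ _) ⟩
    c * t (suc j) + u (suc j)                   ∎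
    where
    p A B : ℤ
    p = c ^ (a ∸ j)
    A = + (a C j)
    B = + (a C suc j)
    expand : ∀ p A B x → p * (A + B) * x ≡ p * B * x + p * A * x
    expand = solve-∀
    shift : ∀ s i → s - (+ 1 + i) ≡ s - + 1 - i
    shift = solve-∀

  scaled : sumTo (suc a) (λ j → c * t j) ≡ c * powerTimes c a f s
  scaled = trans (sumTo-* (suc a) c t)
                 (cong (c *_) (sumTo-truncate t (ℕP.n≤1+n a) beyond-a))
    where
    beyond-a : ∀ j → a < j → t j ≡ + 0
    beyond-a j a<j rewrite k>n⇒nCk≡0 a<j = zero-factor (c ^ (a ∸ j)) (f (s - + j))

  shifted : sumTo (suc a) u ≡ powerTimes c a f (s - + 1)
  shifted = trans (sumTo-shift a u) (ℤP.+-identityˡ _)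

Recurrent : (ℕ → Seq) → Set
Recurrent F = ∀ N → F (suc (suc N)) ≗ λ s → timesXPlus (+ 2) (F (suc N)) s - timesXPlus (+ 1) (F N) s

-- A Pascal-type sequence F(N+1) = (1+x) F(N) is recurrent, since (2+x) - 1 = 1+x.
pascal⇒recurrent : (F : ℕ → Seq) → (∀ N → F (suc N) ≗ timesXPlus (+ 1) (F N)) → Recurrent F
pascal⇒recurrent F step N s = begin
  F (suc (suc N)) s                                  ≡⟨ step (suc N) s ⟩
  + 1 * a + b                                        ≡⟨ regroup a b ⟩
  (+ 2 * a + b) - a                                  ≡⟨ cong (λ v → timesXPlus (+ 2) (F (suc N)) s - v) (step N s) ⟩
  timesXPlus (+ 2) (F (suc N)) s - timesXPlus (+ 1) (F N) s ∎
  where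
  a b : ℤ
  a = F (suc N) s
  b = F (suc N) (s - + 1)
  regroup : ∀ a b → + 1 * a + b ≡ (+ 2 * a + b) - a
  regroup = solve-∀

-- A sequence independent of N is recurrent, since (2+x) - (1+x) = 1.
constant-recurrent : (g : Seq) → Recurrent (λ _ → g)
constant-recurrent g N s = identity (g s) (g (s - + 1))
  where
  identity : ∀ u v → u ≡ (+ 2 * u + v) - (+ 1 * u + v)
  identity = solve-∀

recurrent-difference : (F G : ℕ → Seq) → Recurrent F → Recurrent G →
                       Recurrent (λ N s → F N s - G N s)
recurrent-difference F G recF recG N s =
  trans (cong₂ _-_ (recF N s) (recG N s))
        (linear (F (suc N) s) (F (suc N) (s - + 1)) (F N s) (F N (s - + 1))
                (G (suc N) s) (G (suc N) (s - + 1)) (G N s) (G N (s - + 1)))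
  where
  linear : ∀ a b c d a′ b′ c′ d′ →
    ((+ 2 * a + b) - (+ 1 * c + d)) - ((+ 2 * a′ + b′) - (+ 1 * c′ + d′))
      ≡ (+ 2 * (a - a′) + (b - b′)) - (+ 1 * (c - c′) + (d - d′))
  linear = solve-∀

recurrent-unique : (F G : ℕ → Seq) → Recurrent F → Recurrent G →
                   F 0 ≗ G 0 → F 1 ≗ G 1 → ∀ N → F N ≗ G N
recurrent-unique F G recF recG F0≗G0 F1≗G1 = agree
  where
  agree : ∀ N → F N ≗ G N
  agree zero          = F0≗G0
  agree (suc zero)    = F1≗G1
  agree (suc (suc N)) s =
    trans (recF N s)
          (trans (cong₂ _-_ (timesXPlus-cong (+ 2) (agree (suc N)) s)
                            (timesXPlus-cong (+ 1) (agree N) s))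
                 (sym (recG N s)))

-- The left-hand side: the m-th summand (-1)^m C(N-m, m) (2+x)^(N-2m) (1+x)^m,
-- and the sum of the summands with m ≤ N.
chebTerm : ℕ → ℕ → Seq
chebTerm N m s = (- (+ 1)) ^ m * + ((N ∸ m) C m) * powerTimes (+ 2) (N ∸ 2 ℕ.* m) (binom m) s

chebSum : ℕ → Seq
chebSum N s = sumTo N (λ m → chebTerm N m s)

-- C(N-m, m) = 0 once 2m > N.
chebTerm-vanish : ∀ N m s → N < m ℕ.+ m → chebTerm N m s ≡ + 0
chebTerm-vanish N (suc m) s N<2m rewrite k>n⇒nCk≡0 (ℕP.m<n+o⇒m∸n<o N (suc m) N<2m) =
  zero-factor ((- (+ 1)) ^ suc m) (powerTimes (+ 2) (N ∸ 2 ℕ.* suc m) (binom (suc m)) s)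

chebSum-extend : ∀ N s → sumTo (suc N) (λ m → chebTerm N m s) ≡ chebSum N s
chebSum-extend N s = sumTo-truncate (λ m → chebTerm N m s) (ℕP.n≤1+n N)
  (λ m N<m → chebTerm-vanish N m s (ℕP.<-≤-trans N<m (ℕP.m≤m+n m m)))

chebTerm-zero : ∀ K → chebTerm (suc K) 0 ≗ timesXPlus (+ 2) (chebTerm K 0)
chebTerm-zero K s =
  trans (cong (+ 1 * + 1 *_) (powerTimes-suc (+ 2) K (binom 0) s))
        (sym (timesXPlus-scale (+ 2) (+ 1 * + 1) (powerTimes (+ 2) K (binom 0)) s))

chebTerm-suc : ∀ K m s → chebTerm (suc K) (suc m) s
  ≡ (- (+ 1)) ^ suc m * + ((K ∸ m) C suc m) * powerTimes (+ 2) (K ∸ suc (2 ℕ.* m)) (binom (suc m)) s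
chebTerm-suc K m s =
  cong (λ k → (- (+ 1)) ^ suc m * + ((K ∸ m) C suc m) * powerTimes (+ 2) (suc K ∸ k) (binom (suc m)) s)
       (ℕP.*-suc 2 m)

pascal-diagonal : ∀ N m → (suc N ∸ m) C suc m ≡ (N ∸ m) C suc m ℕ.+ (N ∸ m) C m
pascal-diagonal N m with m ℕ.≤? N
... | yes m≤N =
  trans (cong (_C suc m) (ℕP.+-∸-assoc 1 m≤N))
        (trans (sym (nCk+nC[k+1]≡[n+1]C[k+1] (N ∸ m) m)) (ℕP.+-comm ((N ∸ m) C m) _))
pascal-diagonal N zero    | no m≰N = ⊥-elim (m≰N z≤n)
pascal-diagonal N (suc m) | no m≰N
  rewrite ℕP.m≤n⇒m∸n≡0 (ℕP.≰⇒> m≰N) | ℕP.m≤n⇒m∸n≡0 (ℕP.<⇒≤ (ℕP.≰⇒> m≰N)) = refl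

∸-≤-half : ∀ N m → N ≤ 2 ℕ.* m → N ∸ m ≤ m
∸-≤-half N m N≤2m = ℕP.m≤n+o⇒m∸n≤o N m (subst (N ≤_) (cong (m ℕ.+_) (ℕP.+-identityʳ m)) N≤2m)

-- Either N - 2m ≥ 1 and one factor 2+x can be split off, or C(N-m, m+1) = 0.
split-factor : ∀ N m (f : Seq) s →
  + ((N ∸ m) C suc m) * powerTimes (+ 2) (N ∸ 2 ℕ.* m) f s
    ≡ + ((N ∸ m) C suc m) * timesXPlus (+ 2) (powerTimes (+ 2) (N ∸ suc (2 ℕ.* m)) f) s
split-factor N m f s with suc (2 ℕ.* m) ℕ.≤? N
... | yes 2m<N =
  cong (+ ((N ∸ m) C suc m) *_)
       (trans (cong (λ a → powerTimes (+ 2) a f s) (ℕP.+-∸-assoc 1 2m<N)) (powerTimes-suc (+ 2) (N ∸ suc (2 ℕ.* m)) f s))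
... | no 2m≮N rewrite k>n⇒nCk≡0 {N ∸ m} {suc m} (s≤s (∸-≤-half N m (ℕP.≤-pred (ℕP.≰⇒> 2m≮N)))) = refl

chebTerm-rec : ∀ N m s → chebTerm (suc (suc N)) (suc m) s
  ≡ timesXPlus (+ 2) (chebTerm (suc N) (suc m)) s - timesXPlus (+ 1) (chebTerm N m) s
chebTerm-rec N m s = begin
  chebTerm (suc (suc N)) (suc m) s                ≡⟨ chebTerm-suc (suc N) m s ⟩
  - + 1 * e * + ((suc N ∸ m) C suc m) * X         ≡⟨ cong (λ k → - + 1 * e * + k * X) (pascal-diagonal N m) ⟩
  - + 1 * e * (c₁ + c₂) * X
    ≡⟨ regroup e c₁ c₂ X _ _ (split-factor N m (binom (suc m)) s)
                              (trans (powerTimes-cong (+ 2) (N ∸ 2 ℕ.* m) (binom-pascal m) s)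
                                     (powerTimes-commute (+ 2) (N ∸ 2 ℕ.* m) (+ 1) (binom m) s)) ⟩
  - + 1 * e * c₁ * timesXPlus (+ 2) Y s - e * c₂ * timesXPlus (+ 1) Z s
    ≡⟨ sym (cong₂ _-_ (timesXPlus-scale (+ 2) (- + 1 * e * c₁) Y s) (timesXPlus-scale (+ 1) (e * c₂) Z s)) ⟩
  timesXPlus (+ 2) (λ s → - + 1 * e * c₁ * Y s) s - timesXPlus (+ 1) (chebTerm N m) s
    ≡⟨ sym (cong (_- timesXPlus (+ 1) (chebTerm N m) s) (timesXPlus-cong (+ 2) (chebTerm-suc N m) s)) ⟩
  timesXPlus (+ 2) (chebTerm (suc N) (suc m)) s - timesXPlus (+ 1) (chebTerm N m) s ∎
  where
  e c₁ c₂ X : ℤ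
  Y Z : Seq
  e  = (- (+ 1)) ^ m
  c₁ = + ((N ∸ m) C suc m)
  c₂ = + ((N ∸ m) C m)
  X  = powerTimes (+ 2) (N ∸ 2 ℕ.* m) (binom (suc m)) s
  Y  = powerTimes (+ 2) (N ∸ suc (2 ℕ.* m)) (binom (suc m))
  Z  = powerTimes (+ 2) (N ∸ 2 ℕ.* m) (binom m)
  regroup : ∀ e c₁ c₂ X Y Z → c₁ * X ≡ c₁ * Y → X ≡ Z →
            - + 1 * e * (c₁ + c₂) * X ≡ - + 1 * e * c₁ * Y - e * c₂ * Z
  regroup e c₁ c₂ X Y Z c₁X≡c₁Y X≡Z = begin
    - + 1 * e * (c₁ + c₂) * X            ≡⟨ distribute e c₁ c₂ X ⟩
    - + 1 * e * (c₁ * X) - e * c₂ * X    ≡⟨ cong₂ (λ u v → - + 1 * e * u - e * c₂ * v) c₁X≡c₁Y X≡Z ⟩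
    - + 1 * e * (c₁ * Y) - e * c₂ * Z    ≡⟨ cong (_- e * c₂ * Z) (sym (ℤP.*-assoc (- + 1 * e) c₁ Y)) ⟩
    - + 1 * e * c₁ * Y - e * c₂ * Z      ∎
    where
    distribute : ∀ e c₁ c₂ X → - + 1 * e * (c₁ + c₂) * X ≡ - + 1 * e * (c₁ * X) - e * c₂ * X
    distribute = solve-∀

chebSum-recurrent : Recurrent chebSum
chebSum-recurrent N s = begin
  chebSum (suc (suc N)) s
    ≡⟨ sumTo-shift (suc N) (λ m → chebTerm (suc (suc N)) m s) ⟩
  chebTerm (suc (suc N)) 0 s + sumTo (suc N) (λ m → chebTerm (suc (suc N)) (suc m) s)
    ≡⟨ cong₂ _+_ (chebTerm-zero (suc N) s) (sumTo-cong (suc N) (λ m → chebTerm-rec N m s)) ⟩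
  T₂ 0 + sumTo (suc N) (λ m → T₂ (suc m) - T₁ m)
    ≡⟨ cong (λ v → T₂ 0 + v) (sumTo-difference (suc N) (λ m → T₂ (suc m)) T₁) ⟩
  T₂ 0 + (sumTo (suc N) (λ m → T₂ (suc m)) - sumTo (suc N) T₁)
    ≡⟨ sym (ℤP.+-assoc (T₂ 0) _ _) ⟩
  (T₂ 0 + sumTo (suc N) (λ m → T₂ (suc m))) - sumTo (suc N) T₁
    ≡⟨ cong (_- sumTo (suc N) T₁) (sym (sumTo-shift (suc N) T₂)) ⟩
  sumTo (suc (suc N)) T₂ - sumTo (suc N) T₁
    ≡⟨ cong₂ _-_ (timesXPlus-sum (+ 2) (suc (suc N)) (chebTerm (suc N)) s)
                 (timesXPlus-sum (+ 1) (suc N) (chebTerm N) s) ⟩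
  timesXPlus (+ 2) (λ s → sumTo (suc (suc N)) (λ m → chebTerm (suc N) m s)) s
    - timesXPlus (+ 1) (λ s → sumTo (suc N) (λ m → chebTerm N m s)) s
    ≡⟨ cong₂ _-_ (timesXPlus-cong (+ 2) (chebSum-extend (suc N)) s)
                 (timesXPlus-cong (+ 1) (chebSum-extend N) s) ⟩
  timesXPlus (+ 2) (chebSum (suc N)) s - timesXPlus (+ 1) (chebSum N) s ∎
  where
  T₂ T₁ : ℕ → ℤ
  T₂ m = timesXPlus (+ 2) (chebTerm (suc N) m) s
  T₁ m = timesXPlus (+ 1) (chebTerm N m) s

-- Coefficients of (1+x)^(N+1) / x.
shiftedBinom : ℕ → Seq
shiftedBinom N s = binom (suc N) (+ 1 + s)

-- Coefficients of ((1+x)^(N+1) - 1) / x; binom 0 is the constant polynomial 1.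
closedForm : ℕ → Seq
closedForm N s = shiftedBinom N s - binom 0 (+ 1 + s)

shiftedBinom-pascal : ∀ N → shiftedBinom (suc N) ≗ timesXPlus (+ 1) (shiftedBinom N)
shiftedBinom-pascal N s =
  trans (binom-pascal (suc N) (+ 1 + s))
        (cong (λ k → + 1 * shiftedBinom N s + binom (suc N) k) (reindex s))
  where
  reindex : ∀ s → + 1 + s - + 1 ≡ + 1 + (s - + 1)
  reindex = solve-∀

-- Difference of a Pascal-type family and a constant one.
closedForm-recurrent : Recurrent closedForm
closedForm-recurrent =
  recurrent-difference shiftedBinom (λ _ s → binom 0 (+ 1 + s))
    (pascal⇒recurrent shiftedBinom shiftedBinom-pascal)
    (constant-recurrent (λ s → binom 0 (+ 1 + s)))

chebSum-closedForm-0 : chebSum 0 ≗ closedForm 0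
chebSum-closedForm-0 (+ zero)  = refl
chebSum-closedForm-0 (+ suc k) = refl
chebSum-closedForm-0 -[1+ zero ]  = refl
chebSum-closedForm-0 -[1+ suc k ] = refl

chebSum-closedForm-1 : chebSum 1 ≗ closedForm 1
chebSum-closedForm-1 (+ zero)        = refl
chebSum-closedForm-1 (+ suc zero)    = refl
chebSum-closedForm-1 (+ suc (suc k)) = refl
chebSum-closedForm-1 -[1+ zero ]     = refl
chebSum-closedForm-1 -[1+ suc k ]    = refl

chebyshev-identity : ∀ N → chebSum N ≗ closedForm N
chebyshev-identity = recurrent-unique chebSum closedForm chebSum-recurrent closedForm-recurrent
  chebSum-closedForm-0 chebSum-closedForm-1

half-bound : ∀ N m → N / 2 < m → N < m ℕ.+ m
half-bound N m N/2<m with m ℕ.+ m ℕ.≤? N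
... | no  2m≰N = ℕP.≰⇒> 2m≰N
... | yes 2m≤N = ⊥-elim (ℕP.<⇒≱ N/2<m (subst (ℕ._≤ N / 2) half-of-double (ℕD./-monoˡ-≤ 2 2m≤N)))
  where
  half-of-double : (m ℕ.+ m) / 2 ≡ m
  half-of-double = trans (cong (ℕ._/ 2) double) (ℕD.m*n/n≡m m 2)
    where
    double : m ℕ.+ m ≡ m ℕ.* 2
    double = trans (cong (m ℕ.+_) (sym (ℕP.+-identityʳ m))) (ℕP.*-comm 2 m)

chebTerm-expand : ∀ N m s → chebTerm N m (+ s) ≡
  sumTo (N ∸ 2 ℕ.* m) λ j →
    ((- (+ 1)) ^ m) * ((+ 2) ^ (N ∸ 2 ℕ.* m ∸ j)) * + ((N ∸ m) C m) * + ((N ∸ 2 ℕ.* m) C j)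
      * binom m (+ suc s - + j - + 1)
chebTerm-expand N m s =
  trans (sym (sumTo-* a (e * c) (λ j → (+ 2) ^ (a ∸ j) * + (a C j) * binom m (+ s - + j))))
        (sumTo-cong a λ j →
          trans (rearrange e c ((+ 2) ^ (a ∸ j)) (+ (a C j)) (binom m (+ s - + j)))
                (cong (λ k → e * (+ 2) ^ (a ∸ j) * c * + (a C j) * binom m k) (reindex (+ s) (+ j))))
  where
  a : ℕ
  a = N ∸ 2 ℕ.* m
  e c : ℤ
  e = (- (+ 1)) ^ m
  c = + ((N ∸ m) C m)
  rearrange : ∀ e c p b x → e * c * (p * b * x) ≡ e * p * c * b * x
  rearrange = solve-∀
  reindex : ∀ s j → s - j ≡ + 1 + s - j - + 1
  reindex = solve-∀

proposition1 : (n t : ℕ) → 1 ≤ n → 1 ≤ t → t ≤ n → + (n C t) ≡ rhs n t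
proposition1 zero    _       ()  _  _
proposition1 (suc N) zero    _   () _
proposition1 (suc N) (suc s) _   _  _ = begin
  + (suc N C suc s)                          ≡⟨ cong +_ (sym (ℕP.+-identityʳ (suc N C suc s))) ⟩
  closedForm N (+ s)                         ≡⟨ sym (chebyshev-identity N (+ s)) ⟩
  sumTo N (λ m → chebTerm N m (+ s))         ≡⟨ sumTo-truncate (λ m → chebTerm N m (+ s)) (ℕD.m/n≤m N 2)
                                                  (λ m N/2<m → chebTerm-vanish N m (+ s) (half-bound N m N/2<m)) ⟩
  sumTo (N / 2) (λ m → chebTerm N m (+ s))   ≡⟨ sumTo-cong (N / 2) (λ m → chebTerm-expand N m s) ⟩
  rhs (suc N) (suc s)                        ∎
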